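{- The maximum possible Mostar index $\mathrm{Mo}(G)$ among all connected graphs $G$ of order $n$ is at most $\frac{5}{24}n^3(1+o(1))$ as $n\to\infty$.
   Context: For a graph $G$ and an edge $\{u,v\}\in E(G)$, let $n_G(u,v)$ denote the number of vertices of $G$ that are strictly closer to $u$ than to $v$. The Mostar index of $G$ is $\mathrm{Mo}(G)=\sum_{\{u,v\}\in E(G)}|n_G(u,v)-n_G(v,u)|$. -}

module Defs where

open import Data.Nat using (ℕ; zero; suc; _≤_; _<ᵇ_; ∣_-_∣)
open import Data.Fin using (Fin; toℕ)
open import Data.Bool using (Bool; true; false; if_then_else_; _∧_)
open import Data.List using (map; allFin)
open import Data.Nat.ListAction using (sum)
open import Data.Product using (Σ; _×_)
open import Relation.Binary.PropositionalEquality using (_≡_)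

record Graph (n : ℕ) : Set where
  field
    adj    : Fin n → Fin n → Bool
    sym    : ∀ u v → adj u v ≡ adj v u
    irrefl : ∀ u → adj u u ≡ false
open Graph public

data Walk {n : ℕ} (G : Graph n) : Fin n → Fin n → ℕ → Set where
  here : ∀ {u} → Walk G u u 0
  step : ∀ {u x w k} → adj G u x ≡ true → Walk G x w k → Walk G u w (suc k)

Connected : ∀ {n} → Graph n → Set
Connected {n} G = ∀ (u v : Fin n) → Σ ℕ (Walk G u v)

IsDistance : ∀ {n} → Graph n → (Fin n → Fin n → ℕ) → Set
IsDistance {n} G dist =
  ∀ (u v : Fin n) → Walk G u v (dist u v) × (∀ k → Walk G u v k → dist u v ≤ k)

ΣV : ∀ n → (Fin n → ℕ) → ℕ
ΣV n f = sum (map f (allFin n))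

nG : ∀ {n} → (Fin n → Fin n → ℕ) → Fin n → Fin n → ℕ
nG {n} dist u v = ΣV n (λ w → if dist w u <ᵇ dist w v then 1 else 0)

-- Mostar index: sum over edges {u,v} (each counted once, via toℕ u < toℕ v)
Mo : ∀ {n} → Graph n → (Fin n → Fin n → ℕ) → ℕ
Mo {n} G dist =
  ΣV n (λ u → ΣV n (λ v →
    if (toℕ u <ᵇ toℕ v) ∧ adj G u v
    then ∣ nG dist u v - nG dist v u ∣ else 0))

-- Orient every edge towards the endpoint of larger degree (ties broken by
-- index).  An edge uv contributes at most n − min(deg u, deg v), so
-- Mo(G) ≤ Σ_u c_u (n − c_u), where c_u is the out-degree of u.  Writing
-- x (n − x) = Σ_{j<x} (n − 2j − 1) and exchanging the sums gives
-- Mo(G) ≤ Σ_j N_j (n − 2j − 1) with N_j = #{u : c_u > j}.  The last vertex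
-- z in the orientation order with c_z > j has all its c_z ≥ j + 1
-- out-neighbours outside that set, so N_j ≤ n − j − 1, and finally
-- Σ_j (n − j − 1)(n − 2j − 1) ≤ 5n³/24.
module Submission where

open import Defs renaming (sym to adj-comm)
open import Data.Nat using (ℕ; zero; suc; pred; _+_; _*_; _^_; _∸_; _≤_; _<_; _<ᵇ_; _≤?_; _<?_; ∣_-_∣; z≤n; s≤s)
open import Data.Nat.Properties
open import Data.Nat.Tactic.RingSolver using (solve-∀)
open import Data.Nat.ListAction using () renaming (sum to sumᴸ)
open import Data.Fin using (Fin; zero; suc; toℕ)
open import Data.Fin.Properties using (any?; toℕ<n; toℕ-injective) renaming (_≟_ to _≟ᶠ_)
open import Data.Bool using (Bool; true; false; if_then_else_; _∧_)
open import Data.Bool.Properties using (∧-zeroʳ)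
open import Data.List using (List; filter; tabulate; allFin)
open import Data.List.Properties using (map-tabulate)
open import Data.List.Extrema.Nat using (argmax; argmax-all; f[xs]≤f[argmax])
open import Data.List.Relation.Unary.All as All using ()
open import Data.List.Relation.Unary.All.Properties using (all-filter)
open import Data.List.Membership.Propositional.Properties using (∈-filter⁺; ∈-allFin)
open import Data.Product using (∃; ∃-syntax; _,_; _×_; proj₁; proj₂)
open import Data.Empty using (⊥-elim)
open import Function using (_∘_; id; case_of_)
open import Relation.Nullary using (does; yes; no)
open import Relation.Nullary.Reflects using (ofʸ; ofⁿ)
open import Relation.Unary using (Pred; Decidable)
open import Relation.Binary using (tri<; tri≈; tri>)
open import Relation.Binary.PropositionalEquality
  using (_≡_; _≢_; refl; sym; trans; cong; cong₂; subst; module ≡-Reasoning)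
open import Algebra.Properties.Semiring.Sum +-*-semiring
  using (sum-syntax; sum-cong-≗; sum-replicate-zero; ∑-distrib-+; ∑-comm; *-distribʳ-sum)

𝟙 : Bool → ℕ
𝟙 b = if b then 1 else 0

𝟙≤1 : ∀ b → 𝟙 b ≤ 1
𝟙≤1 true  = ≤-refl
𝟙≤1 false = z≤n

<ᵇ-false : ∀ a b → b ≤ a → (a <ᵇ b) ≡ false
<ᵇ-false a b b≤a with a <ᵇ b | <ᵇ-reflects-< a b
... | true  | ofʸ a<b = ⊥-elim (<⇒≱ a<b b≤a)
... | false | _       = refl

if-∧-≤ : ∀ a b {x y} → (b ≡ true → x ≤ y) → (if a ∧ b then x else 0) ≤ 𝟙 a * y
if-∧-≤ true  true  {y = y} x≤y = ≤-trans (x≤y refl) (≤-reflexive (sym (*-identityˡ y)))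
if-∧-≤ true  false _           = z≤n
if-∧-≤ false _     _           = z≤n

m*o+p≤n*o+q⇒m≤n : ∀ m n {o p q} → q < o → m * o + p ≤ n * o + q → m ≤ n
m*o+p≤n*o+q⇒m≤n m n {o} {p} {q} q<o le with m ≤? n
... | yes m≤n = m≤n
... | no  m≰n = ⊥-elim (<⇒≱ n*o+q<m*o+p le)
  where
  open ≤-Reasoning
  n*o+q<m*o+p : n * o + q < m * o + p
  n*o+q<m*o+p = begin-strict
    n * o + q  <⟨ +-monoʳ-< (n * o) q<o ⟩
    n * o + o  ≡⟨ +-comm (n * o) o ⟩
    suc n * o  ≤⟨ *-monoˡ-≤ o (≰⇒> m≰n) ⟩
    m * o      ≤⟨ m≤m+n (m * o) p ⟩
    m * o + p  ∎

m∸n≤1+m∸[1+n] : ∀ m n → m ∸ n ≤ suc (m ∸ suc n)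
m∸n≤1+m∸[1+n] zero    n       = subst (_≤ 1) (sym (0∸n≡0 n)) z≤n
m∸n≤1+m∸[1+n] (suc m) zero    = ≤-refl
m∸n≤1+m∸[1+n] (suc m) (suc n) = m∸n≤1+m∸[1+n] m n

∑-mono-≤ : ∀ {n} {f g : Fin n → ℕ} → (∀ i → f i ≤ g i) → ∑[ i < n ] f i ≤ ∑[ i < n ] g i
∑-mono-≤ {zero}  _   = z≤n
∑-mono-≤ {suc n} f≤g = +-mono-≤ (f≤g zero) (∑-mono-≤ (f≤g ∘ suc))

∑-const-1 : ∀ n → ∑[ i < n ] 1 ≡ n
∑-const-1 zero    = refl
∑-const-1 (suc n) = cong suc (∑-const-1 n)

∑-δ : ∀ {n} (v : Fin n) → ∑[ w < n ] 𝟙 (does (w ≟ᶠ v)) ≡ 1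
∑-δ {suc n} zero    = cong suc (sum-replicate-zero n)
∑-δ {suc n} (suc v) = ∑-δ v

∑-𝟙<ᵇ : ∀ m c (g : ℕ → ℕ) → c ≤ m →
        ∑[ j < m ] (𝟙 (toℕ j <ᵇ c) * g (toℕ j)) ≡ ∑[ j < c ] g (toℕ j)
∑-𝟙<ᵇ m       zero    g _         = sum-replicate-zero m
∑-𝟙<ᵇ (suc m) (suc c) g (s≤s c≤m) = cong₂ _+_ (*-identityˡ (g 0)) (∑-𝟙<ᵇ m c (g ∘ suc) c≤m)

sumᴸ-tabulate : ∀ {n} (f : Fin n → ℕ) → sumᴸ (tabulate f) ≡ ∑[ i < n ] f i
sumᴸ-tabulate {zero}  f = refl
sumᴸ-tabulate {suc n} f = cong (f zero +_) (sumᴸ-tabulate (f ∘ suc))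

ΣV≡∑ : ∀ n (f : Fin n → ℕ) → ΣV n f ≡ ∑[ i < n ] f i
ΣV≡∑ n f = trans (cong sumᴸ (map-tabulate id f)) (sumᴸ-tabulate f)

∑-ordered-pairs-≤ : ∀ {n} (F : Fin n → Fin n → ℕ) →
  ∑[ u < n ] ∑[ v < n ] (𝟙 (toℕ u <ᵇ toℕ v) * (F u v + F v u)) ≤ ∑[ u < n ] ∑[ v < n ] F u v
∑-ordered-pairs-≤ {n} F = begin
    ∑[ u < n ] ∑[ v < n ] (I u v * (F u v + F v u))
  ≡⟨ sum-cong-≗ (λ u → sum-cong-≗ (λ v → *-distribˡ-+ (I u v) (F u v) (F v u))) ⟩
    ∑[ u < n ] ∑[ v < n ] (I u v * F u v + I u v * F v u)
  ≡⟨ sum-cong-≗ (λ u → ∑-distrib-+ (λ v → I u v * F u v) (λ v → I u v * F v u)) ⟩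
    ∑[ u < n ] (∑[ v < n ] (I u v * F u v) + ∑[ v < n ] (I u v * F v u))
  ≡⟨ ∑-distrib-+ (λ u → ∑[ v < n ] (I u v * F u v)) (λ u → ∑[ v < n ] (I u v * F v u)) ⟩
    ∑[ u < n ] ∑[ v < n ] (I u v * F u v) + ∑[ u < n ] ∑[ v < n ] (I u v * F v u)
  ≡⟨ cong (∑[ u < n ] ∑[ v < n ] (I u v * F u v) +_) (∑-comm (λ u v → I u v * F v u)) ⟩
    ∑[ u < n ] ∑[ v < n ] (I u v * F u v) + ∑[ u < n ] ∑[ v < n ] (I v u * F u v)
  ≡⟨ sym (∑-distrib-+ (λ u → ∑[ v < n ] (I u v * F u v)) (λ u → ∑[ v < n ] (I v u * F u v))) ⟩
    ∑[ u < n ] (∑[ v < n ] (I u v * F u v) + ∑[ v < n ] (I v u * F u v))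
  ≡⟨ sum-cong-≗ (λ u → sym (∑-distrib-+ (λ v → I u v * F u v) (λ v → I v u * F u v))) ⟩
    ∑[ u < n ] ∑[ v < n ] (I u v * F u v + I v u * F u v)
  ≤⟨ ∑-mono-≤ (λ u → ∑-mono-≤ (λ v → at-most-one-order u v)) ⟩
    ∑[ u < n ] ∑[ v < n ] F u v
  ∎
  where
  open ≤-Reasoning
  I : Fin n → Fin n → ℕ
  I u v = 𝟙 (toℕ u <ᵇ toℕ v)
  at-most-one-order : ∀ u v → I u v * F u v + I v u * F u v ≤ F u v
  at-most-one-order u v with toℕ u <ᵇ toℕ v | <ᵇ-reflects-< (toℕ u) (toℕ v)
                           | toℕ v <ᵇ toℕ u | <ᵇ-reflects-< (toℕ v) (toℕ u)
  ... | true  | ofʸ u<v | true  | ofʸ v<u = ⊥-elim (<-asym u<v v<u)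
  ... | true  | _       | false | _       = ≤-reflexive (trans (+-identityʳ _) (*-identityˡ _))
  ... | false | _       | true  | _       = ≤-reflexive (*-identityˡ _)
  ... | false | _       | false | _       = z≤n

∃-maximal : ∀ {n p} {P : Pred (Fin n) p} → Decidable P → (f : Fin n → ℕ) → ∃ P →
            ∃[ m ] P m × (∀ {w} → P w → f w ≤ f m)
∃-maximal {n} P? f (z , Pz) =
  m , argmax-all f Pz (all-filter P? (allFin n)) ,
  λ Pw → All.lookup (f[xs]≤f[argmax] z candidates) (∈-filter⁺ P? (∈-allFin _) Pw)
  where
  candidates : List (Fin n)
  candidates = filter P? (allFin n)
  m : Fin n
  m = argmax f z candidates

-- layer n j = n ∸ (2j + 1), so that x (n ∸ x) ≤ Σ_{j<x} layer n j.
layer : ℕ → ℕ → ℕ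
layer n             zero    = pred n
layer (suc (suc n)) (suc j) = layer n j
layer _             (suc _) = 0

layers : ℕ → ℕ → ℕ
layers m n = ∑[ j < m ] layer n (toℕ j)

weightedLayers : ℕ → ℕ → ℕ
weightedLayers m n = ∑[ j < m ] ((n ∸ suc (toℕ j)) * layer n (toℕ j))

*-∸-step : ∀ c n → suc c * (suc n ∸ c) ≤ suc n + c * (n ∸ c)
*-∸-step c n with c ≤? n
... | yes c≤n = ≤-reflexive (begin
    suc c * (suc n ∸ c)            ≡⟨ cong (suc c *_) (+-∸-assoc 1 c≤n) ⟩
    suc c * suc (n ∸ c)            ≡⟨ expand c (n ∸ c) ⟩
    suc (n ∸ c + c) + c * (n ∸ c)  ≡⟨ cong (λ m → suc m + c * (n ∸ c)) (m∸n+n≡m c≤n) ⟩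
    suc n + c * (n ∸ c)            ∎)
  where
  open ≡-Reasoning
  expand : ∀ c d → suc c * suc d ≡ suc (d + c) + c * d
  expand = solve-∀
... | no c≰n = ≤-trans (≤-reflexive (trans (cong (suc c *_) (m≤n⇒m∸n≡0 (≰⇒> c≰n))) (*-zeroʳ (suc c)))) z≤n

*-∸≤layers : ∀ c n → c * (n ∸ c) ≤ layers c n
*-∸≤layers zero    n             = z≤n
*-∸≤layers (suc c) zero          = ≤-trans (≤-reflexive (*-zeroʳ (suc c))) z≤n
*-∸≤layers (suc c) (suc zero)    =
  ≤-trans (≤-reflexive (trans (cong (suc c *_) (0∸n≡0 c)) (*-zeroʳ (suc c)))) z≤n
*-∸≤layers (suc c) (suc (suc n)) = ≤-trans (*-∸-step c n) (+-monoʳ-≤ (suc n) (*-∸≤layers c n))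

4*layers≤n² : ∀ m n → 4 * layers m n ≤ n * n
4*layers≤n² zero    n             = z≤n
4*layers≤n² (suc m) zero          = ≤-reflexive (cong (4 *_) (sum-replicate-zero m))
4*layers≤n² (suc m) (suc zero)    = ≤-trans (≤-reflexive (cong (4 *_) (sum-replicate-zero m))) z≤n
4*layers≤n² (suc m) (suc (suc n)) = begin
    4 * (suc n + layers m n)        ≡⟨ *-distribˡ-+ 4 (suc n) (layers m n) ⟩
    4 * suc n + 4 * layers m n      ≤⟨ +-monoʳ-≤ (4 * suc n) (4*layers≤n² m n) ⟩
    4 * suc n + n * n               ≡⟨ square n ⟩
    suc (suc n) * suc (suc n)       ∎
  where
  open ≤-Reasoning
  square : ∀ n → 4 * suc n + n * n ≡ suc (suc n) * suc (suc n)
  square = solve-∀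

weightedLayers-step : ∀ m n →
  weightedLayers (suc m) (suc (suc n)) ≤ suc n * suc n + (layers m n + weightedLayers m n)
weightedLayers-step m n = +-monoʳ-≤ (suc n * suc n) (begin
    ∑[ j < m ] ((n ∸ toℕ j) * layer n (toℕ j))
  ≤⟨ ∑-mono-≤ {m} (λ j → *-monoˡ-≤ (layer n (toℕ j)) (m∸n≤1+m∸[1+n] n (toℕ j))) ⟩
    ∑[ j < m ] (layer n (toℕ j) + (n ∸ suc (toℕ j)) * layer n (toℕ j))
  ≡⟨ ∑-distrib-+ {m} (layer n ∘ toℕ) (λ j → (n ∸ suc (toℕ j)) * layer n (toℕ j)) ⟩
    layers m n + weightedLayers m n
  ∎)
  where open ≤-Reasoning

24*weightedLayers≤5n³ : ∀ m n → 24 * weightedLayers m n ≤ 5 * n ^ 3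
24*weightedLayers≤5n³ zero    n             = z≤n
24*weightedLayers≤5n³ (suc m) zero          = ≤-reflexive (cong (24 *_) (sum-replicate-zero m))
24*weightedLayers≤5n³ (suc m) (suc zero)    = ≤-trans (≤-reflexive (cong (24 *_) (sum-replicate-zero m))) z≤n
24*weightedLayers≤5n³ (suc m) (suc (suc n)) = begin
    24 * weightedLayers (suc m) (suc (suc n))
  ≤⟨ *-monoʳ-≤ 24 (weightedLayers-step m n) ⟩
    24 * (suc n * suc n + (layers m n + weightedLayers m n))
  ≡⟨ regroup (suc n * suc n) (layers m n) (weightedLayers m n) ⟩
    24 * (suc n * suc n) + 6 * (4 * layers m n) + 24 * weightedLayers m n
  ≤⟨ +-mono-≤ (+-monoʳ-≤ (24 * (suc n * suc n)) (*-monoʳ-≤ 6 (4*layers≤n² m n)))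
              (24*weightedLayers≤5n³ m n) ⟩
    24 * (suc n * suc n) + 6 * (n * n) + 5 * n ^ 3
  ≤⟨ m≤m+n _ (12 * n + 16) ⟩
    24 * (suc n * suc n) + 6 * (n * n) + 5 * n ^ 3 + (12 * n + 16)
  ≡⟨ cube n ⟩
    5 * suc (suc n) ^ 3
  ∎
  where
  open ≤-Reasoning
  regroup : ∀ a q s → 24 * (a + (q + s)) ≡ 24 * a + 6 * (4 * q) + 24 * s
  regroup = solve-∀
  cube : ∀ n → 24 * (suc n * suc n) + 6 * (n * n) + 5 * (n * (n * (n * 1))) + (12 * n + 16)
             ≡ 5 * (suc (suc n) * (suc (suc n) * (suc (suc n) * 1)))
  cube = solve-∀

module _ {n : ℕ} (G : Graph n) (dist : Fin n → Fin n → ℕ) (isDist : IsDistance G dist) where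

  dist-refl : ∀ v → dist v v ≡ 0
  dist-refl v = n≤0⇒n≡0 (proj₂ (isDist v v) 0 here)

  dist-adj≤1 : ∀ {w v} → adj G w v ≡ true → dist w v ≤ 1
  dist-adj≤1 {w} {v} e = proj₂ (isDist w v) 1 (step e here)

  dist-pos : ∀ {w u} → w ≢ u → 1 ≤ dist w u
  dist-pos {w} {u} w≢u with dist w u | proj₁ (isDist w u)
  ... | zero  | here = ⊥-elim (w≢u refl)
  ... | suc _ | _    = s≤s z≤n

  adj-sym : ∀ {u v} → adj G u v ≡ true → adj G v u ≡ true
  adj-sym {u} {v} e = trans (adj-comm G v u) e

  adj⇒≢ : ∀ {u v} → adj G u v ≡ true → u ≢ v
  adj⇒≢ {u} e refl = case trans (sym (irrefl G u)) e of λ ()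

  deg : Fin n → ℕ
  deg u = ∑[ w < n ] 𝟙 (adj G u w)

  deg≤n : ∀ u → deg u ≤ n
  deg≤n u = subst (deg u ≤_) (∑-const-1 n) (∑-mono-≤ (λ w → 𝟙≤1 (adj G u w)))

  -- Only u is both closer to u than to v and adjacent to v; v is neither.
  closer-or-adjacent : ∀ {u v} → adj G u v ≡ true → ∀ w →
    𝟙 (dist w u <ᵇ dist w v) + 𝟙 (adj G v w) + 𝟙 (does (w ≟ᶠ v)) ≤ 1 + 𝟙 (does (w ≟ᶠ u))
  closer-or-adjacent {u} {v} e w with w ≟ᶠ v | w ≟ᶠ u
  ... | yes refl | _ rewrite dist-refl w | irrefl G w = s≤s z≤n
  ... | no _     | yes refl =
    +-mono-≤ (+-mono-≤ (𝟙≤1 (dist w w <ᵇ dist w v)) (𝟙≤1 (adj G v w))) z≤n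
  ... | no w≢v   | no w≢u with adj G v w in vw
  ...   | true  rewrite <ᵇ-false (dist w u) (dist w v) (≤-trans (dist-adj≤1 (adj-sym vw)) (dist-pos w≢u)) = ≤-refl
  ...   | false = +-mono-≤ (+-mono-≤ (𝟙≤1 (dist w u <ᵇ dist w v)) (z≤n {0})) (z≤n {0})

  nG≤n∸deg : ∀ {u v} → adj G u v ≡ true → nG dist u v ≤ n ∸ deg v
  nG≤n∸deg {u} {v} e = m+n≤o⇒m≤o∸n (nG dist u v) (+-cancelʳ-≤ 1 _ _ (begin
      nG dist u v + deg v + 1
    ≡⟨ cong₂ (λ a b → a + deg v + b) (ΣV≡∑ n _) (sym (∑-δ v)) ⟩
      ∑[ w < n ] closer w + ∑[ w < n ] 𝟙 (adj G v w) + ∑[ w < n ] 𝟙 (does (w ≟ᶠ v))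
    ≡⟨ cong (_+ ∑[ w < n ] 𝟙 (does (w ≟ᶠ v))) (sym (∑-distrib-+ closer (𝟙 ∘ adj G v))) ⟩
      ∑[ w < n ] (closer w + 𝟙 (adj G v w)) + ∑[ w < n ] 𝟙 (does (w ≟ᶠ v))
    ≡⟨ sym (∑-distrib-+ (λ w → closer w + 𝟙 (adj G v w)) (λ w → 𝟙 (does (w ≟ᶠ v)))) ⟩
      ∑[ w < n ] (closer w + 𝟙 (adj G v w) + 𝟙 (does (w ≟ᶠ v)))
    ≤⟨ ∑-mono-≤ (closer-or-adjacent e) ⟩
      ∑[ w < n ] (1 + 𝟙 (does (w ≟ᶠ u)))
    ≡⟨ ∑-distrib-+ (λ _ → 1) (λ w → 𝟙 (does (w ≟ᶠ u))) ⟩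
      ∑[ w < n ] 1 + ∑[ w < n ] 𝟙 (does (w ≟ᶠ u))
    ≡⟨ cong₂ _+_ (∑-const-1 n) (∑-δ u) ⟩
      n + 1
    ∎))
    where
    open ≤-Reasoning
    closer : Fin n → ℕ
    closer w = 𝟙 (dist w u <ᵇ dist w v)

  key : Fin n → ℕ
  key u = deg u * n + toℕ u

  key-deg-mono : ∀ {u v} → key u ≤ key v → deg u ≤ deg v
  key-deg-mono {u} {v} = m*o+p≤n*o+q⇒m≤n (deg u) (deg v) (toℕ<n v)

  key-injective : ∀ {u v} → key u ≡ key v → u ≡ v
  key-injective {u} {v} eq = toℕ-injective (+-cancelˡ-≡ (deg v * n) (toℕ u) (toℕ v) (begin
      deg v * n + toℕ u  ≡⟨ cong (λ d → d * n + toℕ u) (sym deg-eq) ⟩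
      key u              ≡⟨ eq ⟩
      key v              ∎))
    where
    open ≡-Reasoning
    deg-eq : deg u ≡ deg v
    deg-eq = ≤-antisym (key-deg-mono (≤-reflexive eq)) (key-deg-mono (≤-reflexive (sym eq)))

  out : Fin n → Fin n → ℕ
  out u v = 𝟙 (adj G u v ∧ (key u <ᵇ key v))

  outdeg : Fin n → ℕ
  outdeg u = ∑[ v < n ] out u v

  outdeg≤deg : ∀ u → outdeg u ≤ deg u
  outdeg≤deg u = ∑-mono-≤ out≤adj
    where
    out≤adj : ∀ v → out u v ≤ 𝟙 (adj G u v)
    out≤adj v with adj G u v
    ... | true  = 𝟙≤1 (key u <ᵇ key v)
    ... | false = z≤n

  -- Each edge is charged to its endpoint of smaller key.
  charge : Fin n → Fin n → ℕ
  charge u v = out u v * (n ∸ deg u)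

  charge-oriented : ∀ {u v} → adj G u v ≡ true → key u < key v → charge u v ≡ n ∸ deg u
  charge-oriented {u} {v} e ku<kv with adj G u v | key u <ᵇ key v | <ᵇ-reflects-< (key u) (key v)
  ... | true | true  | _        = *-identityˡ (n ∸ deg u)
  ... | true | false | ofⁿ ku≮kv = ⊥-elim (ku≮kv ku<kv)

  edge-term≤charge : ∀ {u v} → adj G u v ≡ true → key u < key v →
                     ∣ nG dist u v - nG dist v u ∣ ≤ charge u v
  edge-term≤charge {u} {v} e ku<kv = ≤-trans (≤-trans (∣m-n∣≤m⊔n (nG dist u v) (nG dist v u)) (⊔-lub
      (≤-trans (nG≤n∸deg e) (∸-monoʳ-≤ n (key-deg-mono (<⇒≤ ku<kv))))
      (nG≤n∸deg (adj-sym e))))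
    (≤-reflexive (sym (charge-oriented e ku<kv)))

  edge-term≤charges : ∀ {u v} → adj G u v ≡ true →
                      ∣ nG dist u v - nG dist v u ∣ ≤ charge u v + charge v u
  edge-term≤charges {u} {v} e with <-cmp (key u) (key v)
  ... | tri< ku<kv _ _ = ≤-trans (edge-term≤charge e ku<kv) (m≤m+n _ _)
  ... | tri≈ _ eq _ = ⊥-elim (adj⇒≢ e (key-injective eq))
  edge-term≤charges {u} {v} e | tri> _ _ kv<ku = ≤-trans
    (subst (_≤ charge v u) (∣-∣-comm (nG dist v u) (nG dist u v)) (edge-term≤charge (adj-sym e) kv<ku))
    (m≤n+m _ _)

  Mo≤∑outdeg : Mo G dist ≤ ∑[ u < n ] (outdeg u * (n ∸ deg u))
  Mo≤∑outdeg = begin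
      Mo G dist
    ≡⟨ trans (ΣV≡∑ n (λ u → ΣV n (term u))) (sum-cong-≗ (λ u → ΣV≡∑ n (term u))) ⟩
      ∑[ u < n ] ∑[ v < n ] term u v
    ≤⟨ ∑-mono-≤ (λ u → ∑-mono-≤ (λ v → term≤charges u v)) ⟩
      ∑[ u < n ] ∑[ v < n ] (𝟙 (toℕ u <ᵇ toℕ v) * (charge u v + charge v u))
    ≤⟨ ∑-ordered-pairs-≤ charge ⟩
      ∑[ u < n ] ∑[ v < n ] charge u v
    ≡⟨ sum-cong-≗ (λ u → sym (*-distribʳ-sum (n ∸ deg u) (out u))) ⟩
      ∑[ u < n ] (outdeg u * (n ∸ deg u))
    ∎
    where
    open ≤-Reasoning
    term : Fin n → Fin n → ℕ
    term u v = if (toℕ u <ᵇ toℕ v) ∧ adj G u v then ∣ nG dist u v - nG dist v u ∣ else 0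
    term≤charges : ∀ u v → term u v ≤ 𝟙 (toℕ u <ᵇ toℕ v) * (charge u v + charge v u)
    term≤charges u v = if-∧-≤ (toℕ u <ᵇ toℕ v) (adj G u v) edge-term≤charges

  outdeg-layers : ∀ u → outdeg u * (n ∸ deg u) ≤ ∑[ j < n ] (𝟙 (toℕ j <ᵇ outdeg u) * layer n (toℕ j))
  outdeg-layers u = begin
      outdeg u * (n ∸ deg u)     ≤⟨ *-monoʳ-≤ (outdeg u) (∸-monoʳ-≤ n (outdeg≤deg u)) ⟩
      outdeg u * (n ∸ outdeg u)  ≤⟨ *-∸≤layers (outdeg u) n ⟩
      layers (outdeg u) n        ≡⟨ sym (∑-𝟙<ᵇ n (outdeg u) (layer n) (≤-trans (outdeg≤deg u) (deg≤n u))) ⟩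
      ∑[ j < n ] (𝟙 (toℕ j <ᵇ outdeg u) * layer n (toℕ j))
    ∎
    where open ≤-Reasoning

  outdeg>-count : ℕ → ℕ
  outdeg>-count j = ∑[ u < n ] 𝟙 (j <ᵇ outdeg u)

  -- A vertex z of maximal key with outdeg z > j has no out-neighbour in that set.
  outdeg>-count≤ : ∀ j → outdeg>-count j ≤ n ∸ suc j
  outdeg>-count≤ j with any? (λ u → j <? outdeg u)
  ... | no ∄ = ≤-trans (≤-reflexive (trans (sum-cong-≗ none) (sum-replicate-zero n))) z≤n
    where
    none : ∀ u → 𝟙 (j <ᵇ outdeg u) ≡ 0
    none u = cong 𝟙 (<ᵇ-false j (outdeg u) (≮⇒≥ (λ j<d → ∄ (u , j<d))))
  ... | yes ∃u with ∃-maximal (λ u → j <? outdeg u) key ∃u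
  ...   | z , j<dz , maximal = m+n≤o⇒m≤o∸n _ (≤-trans (+-monoʳ-≤ (outdeg>-count j) j<dz) (begin
      outdeg>-count j + outdeg z              ≡⟨ sym (∑-distrib-+ (λ w → 𝟙 (j <ᵇ outdeg w)) (out z)) ⟩
      ∑[ w < n ] (𝟙 (j <ᵇ outdeg w) + out z w) ≤⟨ ∑-mono-≤ disjoint ⟩
      ∑[ w < n ] 1                             ≡⟨ ∑-const-1 n ⟩
      n                                        ∎))
    where
    open ≤-Reasoning
    disjoint : ∀ w → 𝟙 (j <ᵇ outdeg w) + out z w ≤ 1
    disjoint w with j <ᵇ outdeg w | <ᵇ-reflects-< j (outdeg w)
    ... | false | _        = 𝟙≤1 (adj G z w ∧ (key z <ᵇ key w))
    ... | true  | ofʸ j<dw = ≤-reflexive (cong (suc ∘ 𝟙) (trans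
      (cong (adj G z w ∧_) (<ᵇ-false (key z) (key w) (maximal j<dw)))
      (∧-zeroʳ (adj G z w))))

  Mo≤weightedLayers : Mo G dist ≤ weightedLayers n n
  Mo≤weightedLayers = begin
      Mo G dist
    ≤⟨ Mo≤∑outdeg ⟩
      ∑[ u < n ] (outdeg u * (n ∸ deg u))
    ≤⟨ ∑-mono-≤ outdeg-layers ⟩
      ∑[ u < n ] ∑[ j < n ] (𝟙 (toℕ j <ᵇ outdeg u) * layer n (toℕ j))
    ≡⟨ ∑-comm {n} {n} (λ u j → 𝟙 (toℕ j <ᵇ outdeg u) * layer n (toℕ j)) ⟩
      ∑[ j < n ] ∑[ u < n ] (𝟙 (toℕ j <ᵇ outdeg u) * layer n (toℕ j))
    ≡⟨ sum-cong-≗ {n} (λ j → sym (*-distribʳ-sum (layer n (toℕ j)) (λ u → 𝟙 (toℕ j <ᵇ outdeg u)))) ⟩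
      ∑[ j < n ] (outdeg>-count (toℕ j) * layer n (toℕ j))
    ≤⟨ ∑-mono-≤ {n} (λ j → *-monoˡ-≤ (layer n (toℕ j)) (outdeg>-count≤ (toℕ j))) ⟩
      weightedLayers n n
    ∎
    where open ≤-Reasoning

24*Mo≤5n³ : ∀ {n} (G : Graph n) (dist : Fin n → Fin n → ℕ) → IsDistance G dist →
            24 * Mo G dist ≤ 5 * n ^ 3
24*Mo≤5n³ {n} G dist isDist =
  ≤-trans (*-monoʳ-≤ 24 (Mo≤weightedLayers G dist isDist)) (24*weightedLayers≤5n³ n n)

24*m≤5*n⇒24*[1+k]*m≤[5*[1+k]+24]*n : ∀ k {m n} → 24 * m ≤ 5 * n → 24 * suc k * m ≤ (5 * suc k + 24) * n
24*m≤5*n⇒24*[1+k]*m≤[5*[1+k]+24]*n k {m} {n} 24m≤5n = begin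
    24 * suc k * m      ≡⟨ reassoc (suc k) m ⟩
    suc k * (24 * m)    ≤⟨ *-monoʳ-≤ (suc k) 24m≤5n ⟩
    suc k * (5 * n)     ≡⟨ reassoc′ (suc k) n ⟩
    5 * suc k * n       ≤⟨ *-monoˡ-≤ n (m≤m+n (5 * suc k) 24) ⟩
    (5 * suc k + 24) * n  ∎
  where
  open ≤-Reasoning
  reassoc : ∀ a b → 24 * a * b ≡ a * (24 * b)
  reassoc = solve-∀
  reassoc′ : ∀ a b → a * (5 * b) ≡ 5 * a * b
  reassoc′ = solve-∀

mainTheorem3 : ∀ (k : ℕ) → ∃[ N ] (∀ (n : ℕ) → N ≤ n → (G : Graph n) → Connected G →
                 (dist : Fin n → Fin n → ℕ) → IsDistance G dist →
                 24 * suc k * Mo G dist ≤ (5 * suc k + 24) * n ^ 3)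
mainTheorem3 k = 0 , λ n _ G _ dist isDist →
  24*m≤5*n⇒24*[1+k]*m≤[5*[1+k]+24]*n k (24*Mo≤5n³ G dist isDist)
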